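{- Let $r\le d$ be positive integers. For integers $s\le 0$, let $N_{d,r}(s)$ denote the number of subsets $\beta\subseteq\{1,2,\dots,s+r-1\}$ (empty if $s+r-1\le 0$) such that (1) $x-s\in\beta$ for all $x\in\beta$ with $x\ge s$; (2) $x-(s+r)\in\beta$ for all $x\in\beta$ with $x\ge s+r$; (3) $\beta$ is $d$-th order twin-free. Then $N_{d,r}(s)=1$ for $s<0$, and $N_{d,r}(0)=N_{d,1}(r)$.
   Context: A set $S\subseteq\mathbb{Z}$ is $d$-th order twin-free if $|x-y|>d$ for all distinct $x,y\in S$. For positive integers $d,s$, $N_{d,1}(s)$ denotes the number of $(s,s+1)$-core partitions with $d$-distinct parts: a partition $\lambda=(\lambda_1,\dots,\lambda_k)$ (finite nonincreasing sequence of positive integers, empty allowed) is $t$-core if no cell of its Young diagram has hook length $t$ (hook length of a cell is $1$ plus the number of cells to its right in its row plus the number below it in its column), $(s,s+1)$-core means $s$-core and $(s+1)$-core, and $\lambda$ has $d$-distinct parts if $\lambda_i-\lambda_{i+1}\ge d$ for $1\le i\le k-1$. -}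

module Defs where

open import Data.Nat using (ℕ; suc; _+_; _∸_; _<_; _≤_; _<ᵇ_)
open import Data.Integer as ℤ using (ℤ; +_)
open import Data.Fin using (Fin; toℕ)
open import Data.List using (List; length; lookup; filterᵇ)
open import Data.List.Relation.Unary.All using (All)
open import Data.List.Relation.Unary.Linked using (Linked)
open import Data.List.Relation.Unary.Unique.Propositional using (Unique)
open import Data.List.Membership.Propositional using (_∈_)
open import Data.Product using (Σ; _×_)
open import Function.Bundles using (_⇔_)
open import Relation.Binary.PropositionalEquality using (_≡_; _≢_)

HasCount : {A : Set} → (A → Set) → ℕ → Set
HasCount {A} P n =
  Σ (List A) (λ L → Unique L × (∀ x → (x ∈ L) ⇔ P x) × length L ≡ n)

-- Subsets β ⊆ {1,…,s+r-1} of ℤ, represented canonically as strictly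
-- increasing lists of integers.

TwinFree : ℕ → List ℤ → Set
TwinFree d β = ∀ x y → x ∈ β → y ∈ β → x ≢ y → + d ℤ.< (+ ℤ.∣ x ℤ.- y ∣)

IsBeta : ℕ → ℕ → ℤ → List ℤ → Set
IsBeta d r s β =
  Linked ℤ._<_ β
  × All (λ x → (+ 1 ℤ.≤ x) × (x ℤ.≤ s ℤ.+ + r ℤ.- + 1)) β
  × (∀ x → x ∈ β → s ℤ.≤ x → (x ℤ.- s) ∈ β)
  × (∀ x → x ∈ β → s ℤ.+ + r ℤ.≤ x → (x ℤ.- (s ℤ.+ + r)) ∈ β)
  × TwinFree d β

-- Partitions as lists of parts (λ₁ ≥ λ₂ ≥ … ≥ λ_k > 0), rows indexed
-- from 0, columns indexed from 0.

IsPartition : List ℕ → Set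
IsPartition p = Linked (λ a b → b ≤ a) p × All (λ a → 0 < a) p

colLen : List ℕ → ℕ → ℕ
colLen p j = length (filterᵇ (λ a → j <ᵇ a) p)

-- hook length of cell (i , j): arm + leg + 1
hook : (p : List ℕ) → Fin (length p) → ℕ → ℕ
hook p i j = (lookup p i ∸ suc j) + (colLen p j ∸ suc (toℕ i)) + 1

IsCore : ℕ → List ℕ → Set
IsCore t p = ∀ (i : Fin (length p)) (j : ℕ) → j < lookup p i → hook p i j ≢ t

DDistinct : ℕ → List ℕ → Set
DDistinct d p = Linked (λ a b → d + b ≤ a) p

IsCoreDD : ℕ → ℕ → List ℕ → Set
IsCoreDD d s p = IsPartition p × IsCore s p × IsCore (suc s) p × DDistinct d p

module Submission where

-- For s < 0, condition (1) sends every x ∈ β to x + |s| ∈ β, so a nonempty β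
-- could not stay below s + r; hence β = ∅. For s = 0 every element lies in
-- [1, r-1], and two of them would be at distance < r ≤ d, so β is ∅ or a
-- singleton {a} with 1 ≤ a ≤ r-1: r choices. If a d-distinct partition
-- has a second part or a first part ≥ r, then λ₂ ≤ λ₁ - r and the cell in
-- column λ₁ - r of the first row has hook length exactly r; the remaining
-- partitions ∅ and (a), a < r, are (r, r+1)-cores.

open import Defs
open import Data.Nat using (ℕ; _≤_)
open import Data.Integer using (ℤ; _<_; +_)
open import Data.Product using (Σ; _×_)

open import Data.Bool using (T)
open import Data.Nat as ℕ using (zero; suc; z≤n; s≤s; _∸_; _<ᵇ_)
import Data.Nat.Properties as ℕ
open import Data.Integer as ℤ using (-[1+_]; +≤+; -≤+; +<+)
import Data.Integer.Properties as ℤ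
open import Data.Fin using () renaming (zero to fzero)
open import Data.List using (List; []; _∷_; [_]; map; downFrom; length; filterᵇ)
open import Data.List.Properties using (length-map; length-downFrom; filter-accept; filter-none; length-filter; ∷-injectiveˡ)
open import Data.List.Relation.Unary.All as All using (All; []; _∷_)
open import Data.List.Relation.Unary.Linked using ([]; [-]; _∷_)
open import Data.List.Relation.Unary.Linked.Properties using (Linked⇒All)
open import Data.List.Relation.Unary.AllPairs using (_∷_)
open import Data.List.Relation.Unary.Unique.Propositional using (Unique)
open import Data.List.Relation.Unary.Unique.Propositional.Properties as Unique using ()
open import Data.List.Membership.Propositional using (_∈_)
open import Data.List.Membership.Propositional.Properties using (∈-map⁺; ∈-map⁻; ∈-downFrom⁺; ∈-downFrom⁻)
open import Data.List.Relation.Unary.Any using (here; there)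
open import Data.Product using (_,_)
open import Data.Empty using (⊥-elim)
open import Function using (_∘_)
open import Function.Bundles using (mk⇔)
open import Relation.Nullary using (¬_)
open import Relation.Nullary.Decidable using (T?)
open import Relation.Binary.PropositionalEquality using (_≡_; _≢_; refl; sym; trans; cong; subst; module ≡-Reasoning)

data EmptyOrSingleton {A : Set} (g : ℕ → A) (m : ℕ) : List A → Set where
  empty     : EmptyOrSingleton g m []
  singleton : ∀ {a} → a ℕ.< m → EmptyOrSingleton g m [ g a ]

hasCount-emptyOrSingleton : {A : Set} {P : List A → Set} (g : ℕ → A) →
  (∀ {a b} → g a ≡ g b → a ≡ b) → (m : ℕ) →
  (∀ {xs} → P xs → EmptyOrSingleton g m xs) →
  (∀ {xs} → EmptyOrSingleton g m xs → P xs) →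
  HasCount P (suc m)
hasCount-emptyOrSingleton {A} g g-injective m classify realise =
  candidates , unique , (λ xs → mk⇔ (realise ∘ listed) (unlisted ∘ classify)) ,
  cong suc (trans (length-map sg (downFrom m)) (length-downFrom m))
  where
  sg : ℕ → List A
  sg a = [ g a ]

  candidates : List (List A)
  candidates = [] ∷ map sg (downFrom m)

  sg-injective : ∀ {a b} → sg a ≡ sg b → a ≡ b
  sg-injective = g-injective ∘ ∷-injectiveˡ

  unique : Unique candidates
  unique = All.tabulate nonempty ∷ Unique.map⁺ sg-injective (Unique.downFrom⁺ m)
    where
    nonempty : ∀ {xs} → xs ∈ map sg (downFrom m) → [] ≢ xs
    nonempty xs∈ eq with _ , _ , refl ← ∈-map⁻ sg xs∈ with () ← eq

  listed : ∀ {xs} → xs ∈ candidates → EmptyOrSingleton g m xs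
  listed (here refl) = empty
  listed (there xs∈) with _ , a∈ , refl ← ∈-map⁻ sg xs∈ = singleton (∈-downFrom⁻ a∈)

  unlisted : ∀ {xs} → EmptyOrSingleton g m xs → xs ∈ candidates
  unlisted empty           = here refl
  unlisted (singleton a<m) = there (∈-map⁺ sg (∈-downFrom⁺ a<m))

¬-shift-closed-bounded : {Q : ℕ → Set} (k m : ℕ) →
  (∀ {b} → Q b → Q (b ℕ.+ suc k)) → (∀ {b} → Q b → b ℕ.< m) → ∀ {a} → ¬ Q a
¬-shift-closed-bounded k zero    shift bounded qa with () ← bounded qa
¬-shift-closed-bounded {Q} k (suc m) shift bounded {a} qa =
  ¬-shift-closed-bounded {Q ∘ suc} k m shift (ℕ.s≤s⁻¹ ∘ bounded) (subst Q (ℕ.+-suc a k) (shift qa))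

IsBeta-[] : ∀ d r s → IsBeta d r s []
IsBeta-[] d r s = [] , [] , (λ _ ()) , (λ _ ()) , (λ _ _ ())

IsBeta-negative⇒[] : ∀ {d r n} β → IsBeta d r -[1+ n ] β → β ≡ []
IsBeta-negative⇒[] [] _ = refl
IsBeta-negative⇒[] (-[1+ _ ] ∷ _) (_ , (() , _) ∷ _ , _)
IsBeta-negative⇒[] {r = r} {n} β@(+ _ ∷ _) (_ , bounds , closed , _) =
  ⊥-elim (¬-shift-closed-bounded n (suc r) shift bounded (here refl))
  where
  shift : ∀ {b} → + b ∈ β → + (b ℕ.+ suc n) ∈ β
  shift b∈ = closed _ b∈ -≤+

  top≤r : -[1+ n ] ℤ.+ + r ℤ.- + 1 ℤ.≤ + r
  top≤r = subst (-[1+ n ] ℤ.+ + r ℤ.- + 1 ℤ.≤_) (cong +_ (ℕ.+-identityʳ r))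
            (ℤ.+-mono-≤ (ℤ.+-monoˡ-≤ (+ r) (-≤+ {n} {0})) (-≤+ {0} {0}))

  bounded : ∀ {b} → + b ∈ β → b ℕ.< suc r
  bounded b∈ with _ , b≤top ← All.lookup bounds b∈ = s≤s (ℤ.drop‿+≤+ (ℤ.≤-trans b≤top top≤r))

twinFree-gap : ∀ {d a b xs} → TwinFree d (+ a ∷ + b ∷ xs) → a ℕ.< b → d ℕ.< b ∸ a
twinFree-gap {d} {a} {b} twinFree a<b = subst (d ℕ.<_) (ℤ.∣⊖∣-≤ (ℕ.<⇒≤ a<b)) (ℤ.drop‿+<+ d<∣a-b∣)
  where
  a≢b : + a ≢ + b
  a≢b eq = ℕ.<-irrefl (ℤ.+-injective eq) a<b

  d<∣a-b∣ : + d ℤ.< + ℤ.∣ a ℤ.⊖ b ∣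
  d<∣a-b∣ = subst (λ i → + d ℤ.< + ℤ.∣ i ∣) (ℤ.[+m]-[+n]≡m⊖n a b)
              (twinFree (+ a) (+ b) (here refl) (there (here refl)) a≢b)

IsBeta-zero⇒emptyOrSingleton : ∀ {d r'} → suc r' ≤ d → ∀ β →
  IsBeta d (suc r') (+ 0) β → EmptyOrSingleton (λ a → + suc a) r' β
IsBeta-zero⇒emptyOrSingleton _ [] _ = empty
IsBeta-zero⇒emptyOrSingleton _ (-[1+ _ ] ∷ _) (_ , (() , _) ∷ _ , _)
IsBeta-zero⇒emptyOrSingleton _ (+ zero ∷ _) (_ , (+≤+ () , _) ∷ _ , _)
IsBeta-zero⇒emptyOrSingleton _ (+ suc a ∷ []) (_ , (_ , +≤+ a<r') ∷ [] , _) = singleton a<r'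
IsBeta-zero⇒emptyOrSingleton _ (+ suc a ∷ -[1+ _ ] ∷ _) (() ∷ _ , _)
IsBeta-zero⇒emptyOrSingleton {d} r≤d (+ suc a ∷ + b ∷ _)
  (+<+ a<b ∷ _ , _ ∷ (_ , +≤+ b≤r') ∷ _ , _ , _ , twinFree) =
  ⊥-elim (ℕ.<-irrefl refl (ℕ.<-≤-trans (twinFree-gap twinFree a<b) gap≤d))
  where
  gap≤d : b ∸ suc a ≤ d
  gap≤d = ℕ.≤-trans (ℕ.m∸n≤m b (suc a)) (ℕ.≤-trans (ℕ.m≤n⇒m≤1+n b≤r') r≤d)

IsBeta-zero-singleton : ∀ {d r' a} → a ℕ.< r' → IsBeta d (suc r') (+ 0) [ + suc a ]
IsBeta-zero-singleton {d} {r'} {a} a<r' =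
  [-] , ((+≤+ (s≤s z≤n) , +≤+ a<r') ∷ []) , closed-0 , closed-r , twinFree
  where
  closed-0 : ∀ x → x ∈ [ + suc a ] → + 0 ℤ.≤ x → (x ℤ.- + 0) ∈ [ + suc a ]
  closed-0 x (here refl) _ = here (ℤ.+-identityʳ x)

  closed-r : ∀ x → x ∈ [ + suc a ] → + 0 ℤ.+ + suc r' ℤ.≤ x → (x ℤ.- (+ 0 ℤ.+ + suc r')) ∈ [ + suc a ]
  closed-r x (here refl) (+≤+ r≤a) = ⊥-elim (ℕ.<-irrefl refl (ℕ.<-≤-trans a<r' (ℕ.s≤s⁻¹ r≤a)))

  twinFree : TwinFree d [ + suc a ]
  twinFree x y (here refl) (here refl) x≢y = ⊥-elim (x≢y refl)

colLen-first : ∀ {m rest} j → j ℕ.< m → All (_≤ j) rest → colLen (m ∷ rest) j ≡ 1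
colLen-first {m} {rest} j j<m rest≤j = begin
  length (filterᵇ (j <ᵇ_) (m ∷ rest))  ≡⟨ cong length (filter-accept (T? ∘ (j <ᵇ_)) {x = m} {xs = rest} (ℕ.<⇒<ᵇ j<m)) ⟩
  suc (length (filterᵇ (j <ᵇ_) rest))  ≡⟨ cong (suc ∘ length) (filter-none (T? ∘ (j <ᵇ_)) (All.map ¬j<x rest≤j)) ⟩
  1                                    ∎
  where
  open ≡-Reasoning
  ¬j<x : ∀ {x} → x ≤ j → ¬ T (j <ᵇ x)
  ¬j<x x≤j j<x = ℕ.<-irrefl refl (ℕ.<-≤-trans (ℕ.<ᵇ⇒< j _ j<x) x≤j)

hook-first-row : ∀ {k t rest} → All (_≤ k) rest → hook (k ℕ.+ suc t ∷ rest) fzero k ≡ suc t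
hook-first-row {k} {t} {rest} rest≤k = begin
  (k ℕ.+ suc t ∸ suc k) ℕ.+ (colLen (k ℕ.+ suc t ∷ rest) k ∸ 1) ℕ.+ 1
    ≡⟨ cong (λ c → (k ℕ.+ suc t ∸ suc k) ℕ.+ (c ∸ 1) ℕ.+ 1) (colLen-first k k<k+1+t rest≤k) ⟩
  (k ℕ.+ suc t ∸ suc k) ℕ.+ 0 ℕ.+ 1
    ≡⟨ cong (λ n → n ∸ suc k ℕ.+ 0 ℕ.+ 1) (ℕ.+-suc k t) ⟩
  (k ℕ.+ t ∸ k) ℕ.+ 0 ℕ.+ 1
    ≡⟨ cong (λ n → n ℕ.+ 0 ℕ.+ 1) (ℕ.m+n∸m≡n k t) ⟩
  t ℕ.+ 0 ℕ.+ 1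
    ≡⟨ cong (ℕ._+ 1) (ℕ.+-identityʳ t) ⟩
  t ℕ.+ 1
    ≡⟨ ℕ.+-comm t 1 ⟩
  suc t ∎
  where
  open ≡-Reasoning
  k<k+1+t : k ℕ.< k ℕ.+ suc t
  k<k+1+t = ℕ.m<m+n k (s≤s z≤n)

IsCore⇒first-part-< : ∀ {t q m rest} → All (_≤ q) rest → IsCore (suc t) (m ∷ rest) → m ℕ.< q ℕ.+ suc t
IsCore⇒first-part-< {t} {q} {m} {rest} rest≤q core = ℕ.≰⇒> q+1+t≰m
  where
  q+1+t≰m : ¬ q ℕ.+ suc t ≤ m
  q+1+t≰m q+1+t≤m = core′ fzero k (ℕ.m<m+n k (s≤s z≤n)) (hook-first-row (All.map (λ x≤q → ℕ.≤-trans x≤q q≤k) rest≤q))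
    where
    k : ℕ
    k = m ∸ suc t

    q≤k : q ≤ k
    q≤k = subst (_≤ k) (ℕ.m+n∸n≡m q (suc t)) (ℕ.∸-monoˡ-≤ (suc t) q+1+t≤m)

    core′ : IsCore (suc t) (k ℕ.+ suc t ∷ rest)
    core′ = subst (λ m′ → IsCore (suc t) (m′ ∷ rest)) (sym (ℕ.m∸n+n≡m (ℕ.≤-trans (ℕ.m≤n+m (suc t) q) q+1+t≤m))) core

hook-singleton-≤ : ∀ a j → hook [ suc a ] fzero j ≤ suc a
hook-singleton-≤ a j
  rewrite ℕ.m≤n⇒m∸n≡0 (length-filter (T? ∘ (j <ᵇ_)) [ suc a ]) | ℕ.+-identityʳ (a ∸ j) | ℕ.+-comm (a ∸ j) 1 =
  s≤s (ℕ.m∸n≤m a j)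

IsCore-singleton : ∀ {a t} → suc a ℕ.< t → IsCore t [ suc a ]
IsCore-singleton {a} a<t fzero j _ hook≡t =
  ℕ.<-irrefl refl (ℕ.<-≤-trans a<t (subst (_≤ suc a) hook≡t (hook-singleton-≤ a j)))

IsCoreDD⇒emptyOrSingleton : ∀ {d r'} → suc r' ≤ d → ∀ p → IsCoreDD d (suc r') p → EmptyOrSingleton suc r' p
IsCoreDD⇒emptyOrSingleton _ [] _ = empty
IsCoreDD⇒emptyOrSingleton _ (zero ∷ []) ((_ , () ∷ _) , _)
IsCoreDD⇒emptyOrSingleton _ (suc a ∷ []) (_ , core , _) = singleton (ℕ.s≤s⁻¹ (IsCore⇒first-part-< {q = 0} [] core))
IsCoreDD⇒emptyOrSingleton {d} {r'} r≤d (m ∷ q ∷ rest) ((_ ∷ decreasing , _) , core , _ , d+q≤m ∷ _) =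
  ⊥-elim (ℕ.<-irrefl refl (ℕ.<-≤-trans (IsCore⇒first-part-< rest≤q core) q+r≤m))
  where
  rest≤q : All (_≤ q) (q ∷ rest)
  rest≤q = Linked⇒All (λ y≤x z≤y → ℕ.≤-trans z≤y y≤x) ℕ.≤-refl decreasing

  q+r≤m : q ℕ.+ suc r' ≤ m
  q+r≤m = ℕ.≤-trans (ℕ.+-monoʳ-≤ q r≤d) (subst (_≤ m) (ℕ.+-comm d q) d+q≤m)

IsCoreDD-singleton : ∀ {d r' a} → a ℕ.< r' → IsCoreDD d (suc r') [ suc a ]
IsCoreDD-singleton a<r' =
  ([-] , s≤s z≤n ∷ []) , IsCore-singleton (s≤s a<r') , IsCore-singleton (s≤s (ℕ.m<n⇒m<1+n a<r')) , [-]

proposition2p6 : (d r : ℕ) → 1 ≤ r → r ≤ d →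
    ((s : ℤ) → s < + 0 → HasCount (IsBeta d r s) 1)
    × Σ ℕ (λ n → HasCount (IsBeta d r (+ 0)) n × HasCount (IsCoreDD d r) n)
proposition2p6 d zero () _
proposition2p6 d (suc r') _ r≤d = count-negative , suc r' , count-zero , count-cores
  where
  count-negative : (s : ℤ) → s < + 0 → HasCount (IsBeta d (suc r') s) 1
  count-negative (+ _) (+<+ ())
  count-negative -[1+ n ] _ = hasCount-emptyOrSingleton +_ ℤ.+-injective 0 classify realise
    where
    classify : ∀ {β} → IsBeta d (suc r') -[1+ n ] β → EmptyOrSingleton +_ 0 β
    classify {β} isBeta rewrite IsBeta-negative⇒[] {r = suc r'} β isBeta = empty
    realise : ∀ {β} → EmptyOrSingleton +_ 0 β → IsBeta d (suc r') -[1+ n ] β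
    realise empty = IsBeta-[] d (suc r') -[1+ n ]

  count-zero : HasCount (IsBeta d (suc r') (+ 0)) (suc r')
  count-zero = hasCount-emptyOrSingleton (λ a → + suc a) (ℕ.suc-injective ∘ ℤ.+-injective) r'
    (IsBeta-zero⇒emptyOrSingleton r≤d _) λ where
      empty           → IsBeta-[] d (suc r') (+ 0)
      (singleton a<r') → IsBeta-zero-singleton a<r'

  count-cores : HasCount (IsCoreDD d (suc r')) (suc r')
  count-cores = hasCount-emptyOrSingleton suc ℕ.suc-injective r'
    (IsCoreDD⇒emptyOrSingleton r≤d _) λ where
      empty            → ([] , []) , (λ ()) , (λ ()) , []
      (singleton a<r') → IsCoreDD-singleton a<r'
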